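{- Let $H$ be a connected graph. For every positive integer $k$ there exists a positive integer $q=q(k,H)$ such that the $q$-bookpile $H(q)$ of $H$ is $k$-connected.
   Context: For a graph $F$, an independent set $I\subseteq V(F)$ and a positive integer $q$, the $q$-book $F_I^q$ is obtained by taking $q$ vertex-disjoint copies of $F$ and identifying, for each $x\in I$, the $q$ copies of $x$. Let $H$ have vertex set $\{v_1,\dots,v_r\}$. Define graphs $H_0,\dots,H_r$ whose vertices each carry a type in $V(H)$: $H_0=H$, where $v_j$ has type $v_j$. For $1\le i\le r$, let $U_i$ be the set of vertices of type $v_i$ in $H_{i-1}$ (an independent set, as edges only join vertices of different types), and let $H_i=(H_{i-1})^q_{U_i}$, each vertex inheriting the type of the vertex of $H_{i-1}$ it is a copy of. The $q$-bookpile of $H$ is $H(q):=H_r$ (it does not depend on the enumeration of $V(H)$). -}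

module Defs where

open import Data.Nat using (ℕ; suc; _<_)
open import Data.Fin using (Fin; _≟_)
open import Data.Bool using (Bool; true; false)
open import Data.Unit using (⊤)
open import Data.Product using (Σ; _×_; _,_)
open import Data.List using (List; length; foldl; allFin)
open import Data.List.Membership.Propositional using (_∉_)
open import Relation.Nullary using (¬_)
open import Relation.Nullary.Decidable using (⌊_⌋)
open import Relation.Binary.PropositionalEquality using (_≡_)
open import Function.Definitions using (Injective)

record Graph : Set₁ where
  field
    V : Set
    E : V → V → Set

record FinGraph (r : ℕ) : Set₁ where
  field
    adj   : Fin r → Fin r → Set
    sym   : ∀ {x y} → adj x y → adj y x
    irrefl : ∀ {x} → ¬ adj x x

toGraph : ∀ {r} → FinGraph r → Graph
toGraph {r} H = record { V = Fin r ; E = FinGraph.adj H }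

data Walk (G : Graph) (ok : Graph.V G → Set) : Graph.V G → Graph.V G → Set where
  here : ∀ {x} → ok x → Walk G ok x x
  step : ∀ {x y z} → ok x → Graph.E G x y → Walk G ok y z → Walk G ok x z

Connected : Graph → Set
Connected G = Graph.V G × (∀ x y → Walk G (λ _ → ⊤) x y)

-- k-connected: more than k vertices, and deleting any set X of fewer than
-- k vertices leaves a connected graph (X given as a list; duplicates harmless).
KConnected : ℕ → Graph → Set
KConnected k G =
  Σ (Fin (suc k) → Graph.V G) (λ f → Injective _≡_ _≡_ f) ×
  (∀ (X : List (Graph.V G)) → length X < k →
     ∀ x y → x ∉ X → y ∉ X → Walk G (λ v → v ∉ X) x y)

record TGraph (r : ℕ) : Set₁ where
  field
    V    : Set
    E    : V → V → Set
    type : V → Fin r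

forget : ∀ {r} → TGraph r → Graph
forget G = record { V = TGraph.V G ; E = TGraph.E G }

-- Copy index of a vertex of the book: none if the vertex is identified
-- (lies in I), otherwise one of the q copies.
CopyIx : ℕ → Bool → Set
CopyIx q true  = ⊤
CopyIx q false = Fin q

-- Two copy-indices are compatible (the vertices lie in a common copy of F).
Compat : ∀ q (b₁ b₂ : Bool) → CopyIx q b₁ → CopyIx q b₂ → Set
Compat q false false c d = c ≡ d
Compat q true  _     _ _ = ⊤
Compat q false true  _ _ = ⊤

-- q-book of G with respect to I = {vertices of type i}: q disjoint copies of G
-- with all copies of each vertex of I identified.
book : ∀ {r} → ℕ → Fin r → TGraph r → TGraph r
book {r} q i G = record
  { V    = Σ V (λ x → CopyIx q (inI x))
  ; E    = λ { (x , c) (y , d) → E x y × Compat q (inI x) (inI y) c d }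
  ; type = λ { (x , _) → type x }
  }
  where
  open TGraph G
  inI : V → Bool
  inI x = ⌊ type x ≟ i ⌋

typed : ∀ {r} → FinGraph r → TGraph r
typed {r} H = record { V = Fin r ; E = FinGraph.adj H ; type = λ x → x }

-- The q-bookpile H(q) = H_r, with H_i = (H_{i-1})^q_{U_i}.
bookpile : ∀ {r} → ℕ → FinGraph r → TGraph r
bookpile {r} q H = foldl (λ G i → book q i G) (typed H) (allFin r)

-- A vertex u of H(q) is determined by its type and, for every other type j, the copy
-- coord j u ∈ Fin q into which the booking of j put it. Along an edge of H from the type
-- of u to a type b one can step to a neighbour of type b lying in any prescribed copy t of
-- the type just left, all other copies unchanged. Following a walk of H through all types
-- therefore leads from any vertex to the unique "corner" of type z lying in copy t for
-- every type, and every vertex entered on the way lies in copy t of some type. A set X of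
-- fewer than k vertices uses at most r(k-1) copies, so for q = rk + 1 some t is used by no
-- vertex of X, and the walks to the t-corner avoid X. The corners for k + 1 different
-- values of t are k + 1 distinct vertices.
module Submission where

open import Defs
open import Data.Nat using (ℕ; suc; _≤_; _<_; _*_; _+_; s≤s; z≤n)
open import Data.Nat.Properties
  using (≤-<-trans; <⇒≤; <⇒≱; n<1+n; m≤n*m; *-monoʳ-≤; *-suc; *-zeroʳ)
open import Data.Fin using (Fin; zero; suc; _≟_; inject≤)
open import Data.Fin.Properties using (any?; injective⇒≤; inject≤-injective; nonZeroIndex)
open import Data.Maybe using (Maybe; just; nothing)
open import Data.Maybe.Properties using (just-injective)
import Data.Maybe.Properties as Maybe
open import Data.Bool using (true; false; if_then_else_)
open import Data.Unit using (⊤; tt)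
open import Data.Product using (Σ; Σ-syntax; ∃; _×_; _,_; proj₁; proj₂)
open import Data.Sum using (_⊎_; inj₁; inj₂)
open import Data.List using (List; []; _∷_; _++_; length; map; concatMap; foldl; allFin; lookup)
open import Data.List.Properties using (length-++; length-map; length-tabulate)
open import Data.List.Membership.Propositional using (_∈_; _∉_)
open import Data.List.Membership.Propositional.Properties
  using (∈-allFin; ∈-map⁺; ∈-concatMap⁺)
open import Data.List.Relation.Unary.Any using (here; there; index)
import Data.List.Relation.Unary.Any as Any
open import Data.List.Relation.Unary.Any.Properties using (lookup-index)
open import Data.List.Relation.Unary.All.Properties using (All¬⇒¬Any)
open import Data.List.Relation.Unary.AllPairs using (_∷_)
open import Data.List.Relation.Unary.Unique.Propositional using (Unique)
open import Data.List.Relation.Unary.Unique.Propositional.Properties using (allFin⁺)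
open import Relation.Nullary using (Dec; yes; no; ¬?; contradiction)
open import Relation.Nullary.Decidable using (⌊_⌋; decidable-stable)
open import Relation.Binary.Definitions using (DecidableEquality)
open import Relation.Binary.PropositionalEquality
  using (_≡_; _≢_; refl; sym; trans; cong; cong₂; subst; module ≡-Reasoning)
open import Function using (id)
open import Function.Definitions using (Injective)

module _ {G : Graph} {ok : Graph.V G → Set} where
  open Graph G

  infixr 5 _++ʷ_

  _++ʷ_ : ∀ {x y z} → Walk G ok x y → Walk G ok y z → Walk G ok x z
  here _       ++ʷ w′ = w′
  step o e w   ++ʷ w′ = step o e (w ++ʷ w′)

  head-ok : ∀ {x y} → Walk G ok x y → ok x
  head-ok (here o)     = o
  head-ok (step o _ _) = o

  reverse : (∀ {x y} → E x y → E y x) → ∀ {x y} → Walk G ok x y → Walk G ok y x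
  reverse E-sym (here o)     = here o
  reverse E-sym (step o e w) = reverse E-sym w ++ʷ step (head-ok w) (E-sym e) (here o)

  visits : ∀ {x y} → Walk G ok x y → List V
  visits (here {x} _)     = x ∷ []
  visits (step {x} _ _ w) = x ∷ visits w

  head-∈-visits : ∀ {x y} (w : Walk G ok x y) → x ∈ visits w
  head-∈-visits (here _)     = here refl
  head-∈-visits (step _ _ _) = here refl

  ∈-visits-++ʷʳ : ∀ {x y z v} (w : Walk G ok x y) {w′ : Walk G ok y z} →
                  v ∈ visits w′ → v ∈ visits (w ++ʷ w′)
  ∈-visits-++ʷʳ (here _)     v∈w′ = v∈w′
  ∈-visits-++ʷʳ (step _ _ w) v∈w′ = there (∈-visits-++ʷʳ w v∈w′)

  spanning-walk : (∀ x y → Walk G ok x y) → (L : List V) → ∀ x y →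
                  Σ[ w ∈ Walk G ok x y ] (∀ {v} → v ∈ L → v ∈ visits w)
  spanning-walk walk []      x y = walk x y , λ ()
  spanning-walk walk (l ∷ L) x y = walk x l ++ʷ w , spans
    where
    w = proj₁ (spanning-walk walk L l y)
    spans : ∀ {v} → v ∈ l ∷ L → v ∈ visits (walk x l ++ʷ w)
    spans (here refl) = ∈-visits-++ʷʳ (walk x l) (head-∈-visits w)
    spans (there v∈L) = ∈-visits-++ʷʳ (walk x l) (proj₂ (spanning-walk walk L l y) v∈L)

fresh-image : ∀ {m} {A : Set} → DecidableEquality A → {f : Fin m → A} →
              Injective _≡_ _≡_ f → (L : List A) → length L < m → ∃ λ t → f t ∉ L
fresh-image {m} _≟ᴬ_ {f} f-injective L |L|<m with any? (λ t → ¬? (Any.any? (f t ≟ᴬ_) L))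
... | yes fresh = fresh
... | no ¬fresh = contradiction (injective⇒≤ position-injective) (<⇒≱ |L|<m)
  where
  f∈L : ∀ t → f t ∈ L
  f∈L t = decidable-stable (Any.any? (f t ≟ᴬ_) L) (λ f∉L → ¬fresh (t , f∉L))
  position-injective : Injective _≡_ _≡_ (λ t → index (f∈L t))
  position-injective {s} {t} eq = f-injective (begin
    f s                       ≡⟨ lookup-index (f∈L s) ⟩
    lookup L (index (f∈L s))  ≡⟨ cong (lookup L) eq ⟩
    lookup L (index (f∈L t))  ≡⟨ lookup-index (f∈L t) ⟨
    f t                       ∎)
    where open ≡-Reasoning

compat-sym : ∀ {q} b₁ b₂ {c d} → Compat q b₁ b₂ c d → Compat q b₂ b₁ d c
compat-sym false false c≡d = sym c≡d
compat-sym false true  _   = tt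
compat-sym true  false _   = tt
compat-sym true  true  _   = tt

some-copy : ∀ {q} b → CopyIx (suc q) b
some-copy true  = tt
some-copy false = zero

module _ {r : ℕ} where

  Symmetric : TGraph r → Set
  Symmetric G = ∀ {u v} → TGraph.E G u v → TGraph.E G v u

  foldl-book-preserves : ∀ {ℓ} {P : TGraph r → Set ℓ} {q} →
                         (∀ i {G} → P G → P (book q i G)) →
                         ∀ L {G} → P G → P (foldl (λ G i → book q i G) G L)
  foldl-book-preserves preserve []      PG = PG
  foldl-book-preserves preserve (i ∷ L) PG = foldl-book-preserves preserve L (preserve i PG)

  book-symmetric : ∀ q i {G} → Symmetric G → Symmetric (book q i G)
  book-symmetric q i {G} E-sym {x , _} {y , _} (e , compat) =
    E-sym e , compat-sym ⌊ TGraph.type G x ≟ i ⌋ ⌊ TGraph.type G y ≟ i ⌋ compat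

  book-inhabited : ∀ q i {G : TGraph r} → TGraph.V G → TGraph.V (book (suc q) i G)
  book-inhabited q i x = x , some-copy _

  bookpile-symmetric : ∀ q (H : FinGraph r) → Symmetric (bookpile q H)
  bookpile-symmetric q H =
    foldl-book-preserves {P = Symmetric} (λ i → book-symmetric q i) (allFin r) (FinGraph.sym H)

  bookpile-inhabited : ∀ q (H : FinGraph r) → Fin r → TGraph.V (bookpile (suc q) H)
  bookpile-inhabited q H =
    foldl-book-preserves {P = TGraph.V} (λ i {G} → book-inhabited q i {G}) (allFin r)

module _ {r : ℕ} (q : ℕ) (H : FinGraph r) where
  open FinGraph H using (adj)

  adj⇒≢ : ∀ {a b} → adj a b → a ≢ b
  adj⇒≢ e refl = FinGraph.irrefl H e

  -- coord j u is the copy containing u made when type j was booked; it is nothing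
  -- while j is still pending and when u has type j (such vertices were identified).
  record CopyCoordinates (G : TGraph r) (pending : List (Fin r)) : Set₁ where
    open TGraph G
    field
      coord            : Fin r → V → Maybe (Fin q)
      coord-own        : ∀ u → coord (type u) u ≡ nothing
      coord-pending    : ∀ {j} u → j ∈ pending → coord j u ≡ nothing
      coord-injective  : ∀ {u v} → type u ≡ type v → (∀ j → coord j u ≡ coord j v) →
                         u ≡ v
      move             : ∀ u {b} → adj (type u) b → Fin q → V
      move-type        : ∀ u {b} (e : adj (type u) b) t → type (move u e t) ≡ b
      move-edge        : ∀ u {b} (e : adj (type u) b) t → E u (move u e t)
      move-coord-own   : ∀ u {b} (e : adj (type u) b) t → type u ∉ pending →
                         coord (type u) (move u e t) ≡ just t
      move-coord-other : ∀ u {b} (e : adj (type u) b) t {j} → j ≢ type u → j ≢ b →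
                         coord j (move u e t) ≡ coord j u

  typed-coordinates : CopyCoordinates (typed H) (allFin r)
  typed-coordinates = record
    { coord            = λ _ _ → nothing
    ; coord-own        = λ _ → refl
    ; coord-pending    = λ _ _ → refl
    ; coord-injective  = λ same-type _ → same-type
    ; move             = λ _ {b} _ _ → b
    ; move-type        = λ _ _ _ → refl
    ; move-edge        = λ _ e _ → e
    ; move-coord-own   = λ u _ _ u∉ → contradiction (∈-allFin u) u∉
    ; move-coord-other = λ _ _ _ _ _ → refl
    }

  copy-coord : ∀ {P : Set} (d : Dec P) → CopyIx q ⌊ d ⌋ → Maybe (Fin q)
  copy-coord (yes _) _ = nothing
  copy-coord (no _)  c = just c

  copy-coord-injective : ∀ {P : Set} (d : Dec P) {c c′} →
                         copy-coord d c ≡ copy-coord d c′ → c ≡ c′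
  copy-coord-injective (yes _) _  = refl
  copy-coord-injective (no _)  eq = just-injective eq

  -- Leaving an identified vertex the step may enter any copy t; otherwise it stays in c.
  next-copy : ∀ {P Q : Set} (d : Dec P) (d′ : Dec Q) →
              Fin q → CopyIx q ⌊ d ⌋ → CopyIx q ⌊ d′ ⌋
  next-copy _       (yes _) _ _ = tt
  next-copy (yes _) (no _)  t _ = t
  next-copy (no _)  (no _)  _ c = c

  next-copy-compat : ∀ {P Q : Set} (d : Dec P) (d′ : Dec Q) t c →
                     Compat q ⌊ d ⌋ ⌊ d′ ⌋ c (next-copy d d′ t c)
  next-copy-compat (yes _) (yes _) _ _ = tt
  next-copy-compat (no _)  (yes _) _ _ = tt
  next-copy-compat (yes _) (no _)  _ _ = tt
  next-copy-compat (no _)  (no _)  _ _ = refl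

  module _ {G : TGraph r} {i : Fin r} {pending : List (Fin r)}
           (cc : CopyCoordinates G (i ∷ pending)) (i∉pending : i ∉ pending) where
    open TGraph G
    open CopyCoordinates cc

    private
      B = book q i G
    open TGraph B using () renaming (V to Vᴮ; type to typeᴮ)

    book-coord : Fin r → Vᴮ → Maybe (Fin q)
    book-coord j (x , c) = if ⌊ j ≟ i ⌋ then copy-coord (type x ≟ i) c else coord j x

    book-coord-booked : ∀ x c → book-coord i (x , c) ≡ copy-coord (type x ≟ i) c
    book-coord-booked x c with i ≟ i
    ... | yes _ = refl
    ... | no i≢i = contradiction refl i≢i

    book-coord-other : ∀ {j} x c → j ≢ i → book-coord j (x , c) ≡ coord j x
    book-coord-other {j} x c j≢i with j ≟ i
    ... | yes j≡i = contradiction j≡i j≢i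
    ... | no _    = refl

    book-move : ∀ (u : Vᴮ) {b} → adj (typeᴮ u) b → Fin q → Vᴮ
    book-move (x , c) e t = move x e t , next-copy (type x ≟ i) (type (move x e t) ≟ i) t c

    book-coord-own : ∀ u → book-coord (typeᴮ u) u ≡ nothing
    book-coord-own (x , c) with type x ≟ i
    ... | yes _ = refl
    ... | no _  = coord-own x

    book-coord-pending : ∀ {j} u → j ∈ pending → book-coord j u ≡ nothing
    book-coord-pending {j} (x , c) j∈pending with j ≟ i
    ... | yes refl = contradiction j∈pending i∉pending
    ... | no _     = coord-pending x (there j∈pending)

    book-coord-injective : ∀ {u v} → typeᴮ u ≡ typeᴮ v →
                           (∀ j → book-coord j u ≡ book-coord j v) → u ≡ v
    book-coord-injective {x , c} {y , d} same-type same-coord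
      with coord-injective same-type same-base-coord
      where
      same-base-coord : ∀ j → coord j x ≡ coord j y
      same-base-coord j with j ≟ i
      ... | yes refl = trans (coord-pending x (here refl)) (sym (coord-pending y (here refl)))
      ... | no j≢i   = trans (sym (book-coord-other x c j≢i))
                         (trans (same-coord j) (book-coord-other y d j≢i))
    ... | refl = cong (x ,_) (copy-coord-injective (type x ≟ i) (begin
      copy-coord (type x ≟ i) c  ≡⟨ book-coord-booked x c ⟨
      book-coord i (x , c)       ≡⟨ same-coord i ⟩
      book-coord i (x , d)       ≡⟨ book-coord-booked x d ⟩
      copy-coord (type x ≟ i) d  ∎))
      where open ≡-Reasoning

    book-move-coord-own : ∀ u {b} (e : adj (typeᴮ u) b) t →
                          typeᴮ u ∉ pending →
                          book-coord (typeᴮ u) (book-move u e t) ≡ just t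
    book-move-coord-own (x , c) e t x∉pending with type x ≟ i
    ... | no x≢i = move-coord-own x e t
                     λ { (here x≡i) → x≢i x≡i ; (there x∈pending) → x∉pending x∈pending }
    ... | yes x≡i with type (move x e t) ≟ i
    ...   | yes y≡i =
      contradiction (trans (trans x≡i (sym y≡i)) (move-type x e t)) (adj⇒≢ e)
    ...   | no _ = refl

    book-move-coord-other : ∀ u {b} (e : adj (typeᴮ u) b) t {j} → j ≢ typeᴮ u → j ≢ b →
                            book-coord j (book-move u e t) ≡ book-coord j u
    book-move-coord-other (x , c) e t {j} j≢x j≢b with j ≟ i
    ... | no _     = move-coord-other x e t j≢x j≢b
    ... | yes refl with type x ≟ i | type (move x e t) ≟ i
    ...   | yes x≡i | _       = contradiction (sym x≡i) j≢x
    ...   | no _    | yes y≡i = contradiction (trans (sym y≡i) (move-type x e t)) j≢b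
    ...   | no _    | no _    = refl

    book-coordinates : CopyCoordinates B pending
    book-coordinates = record
      { coord            = book-coord
      ; coord-own        = book-coord-own
      ; coord-pending    = book-coord-pending
      ; coord-injective  = book-coord-injective
      ; move             = book-move
      ; move-type        = λ { (x , _) e t → move-type x e t }
      ; move-edge        = λ { (x , c) e t →
                                 move-edge x e t , next-copy-compat (type x ≟ i) _ t c }
      ; move-coord-own   = book-move-coord-own
      ; move-coord-other = book-move-coord-other
      }

  foldl-book-coordinates : ∀ L {G} → Unique L → CopyCoordinates G L →
                           CopyCoordinates (foldl (λ G i → book q i G) G L) []
  foldl-book-coordinates []      _              cc = cc
  foldl-book-coordinates (i ∷ L) (i∉L ∷ unique) cc =
    foldl-book-coordinates L unique (book-coordinates cc (All¬⇒¬Any i∉L))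

  bookpile-coordinates : CopyCoordinates (bookpile q H) []
  bookpile-coordinates = foldl-book-coordinates (allFin r) (allFin⁺ r) typed-coordinates

module _ {r q : ℕ} {H : FinGraph r} {G : TGraph r} (cc : CopyCoordinates q H G [])
         (G-sym : Symmetric G) (H-walk : ∀ a b → Walk (toGraph H) (λ _ → ⊤) a b) where
  open TGraph G
  open CopyCoordinates cc

  Avoids : List V → Fin q → Set
  Avoids X t = ∀ j {x} → x ∈ X → coord j x ≢ just t

  Lifted : List V → Fin q → V → Fin r → List (Fin r) → Set
  Lifted X t u a S =
    Σ[ e ∈ V ] type e ≡ a × Walk (forget G) (_∉ X) u e ×
               (∀ j → j ≢ a → j ∈ S ⊎ coord j u ≡ just t → coord j e ≡ just t)

  -- Every vertex entered along an edge lies in copy t of the type just left, so it avoids X.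
  lift-walk : ∀ {X t} → Avoids X t → ∀ {u a₀ a} → u ∉ X → type u ≡ a₀ →
              (w : Walk (toGraph H) (λ _ → ⊤) a₀ a) → Lifted X t u a (visits w)
  lift-walk {t = t} avoids {u} u∉X refl (here _) = u , refl , here u∉X , stay
    where
    stay : ∀ j → j ≢ type u → j ∈ type u ∷ [] ⊎ coord j u ≡ just t → coord j u ≡ just t
    stay j j≢u (inj₁ (here j≡u)) = contradiction j≡u j≢u
    stay j _   (inj₂ in-t)       = in-t
  lift-walk {X} {t} avoids {u} u∉X refl (step {y = b} _ e w)
    with lift-walk avoids u′∉X (move-type u e t) w
    where
    u′∉X : move u e t ∉ X
    u′∉X u′∈X = avoids (type u) u′∈X (move-coord-own u e t λ ())
  ... | end , end-type , walk , end-coord =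
    end , end-type , step u∉X (move-edge u e t) walk , extend
    where
    extend : ∀ j → j ≢ _ → j ∈ type u ∷ visits w ⊎ coord j u ≡ just t → coord j end ≡ just t
    extend j j≢a (inj₁ (here refl)) = end-coord j j≢a (inj₂ (move-coord-own u e t λ ()))
    extend j j≢a (inj₁ (there j∈w)) = end-coord j j≢a (inj₁ j∈w)
    extend j j≢a (inj₂ in-t) with j ≟ b
    ... | yes refl = end-coord j j≢a (inj₁ (head-∈-visits w))
    ... | no j≢b   = end-coord j j≢a (inj₂ (trans (move-coord-other u e t j≢u j≢b) in-t))
      where
      j≢u : j ≢ type u
      j≢u refl with () ← trans (sym (coord-own u)) in-t

  corner-unique : ∀ {z t e₁ e₂} → type e₁ ≡ z → type e₂ ≡ z →
                  (∀ j → j ≢ z → coord j e₁ ≡ just t) →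
                  (∀ j → j ≢ z → coord j e₂ ≡ just t) → e₁ ≡ e₂
  corner-unique {e₁ = e₁} {e₂} refl e₂-type in-t₁ in-t₂ =
    coord-injective (sym e₂-type) same-coord
    where
    same-coord : ∀ j → coord j e₁ ≡ coord j e₂
    same-coord j with j ≟ type e₁
    ... | yes refl = trans (coord-own e₁)
                       (sym (subst (λ j → coord j e₂ ≡ nothing) e₂-type (coord-own e₂)))
    ... | no j≢z   = trans (in-t₁ j j≢z) (sym (in-t₂ j j≢z))

  record CornerWalk (X : List V) (t : Fin q) (z : Fin r) (u : V) : Set where
    field
      corner       : V
      corner-type  : type corner ≡ z
      walk         : Walk (forget G) (_∉ X) u corner
      corner-coord : ∀ j → j ≢ z → coord j corner ≡ just t

  corner-walk : ∀ {X t} → Avoids X t → (z : Fin r) → ∀ {u} → u ∉ X → CornerWalk X t z u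
  corner-walk avoids z {u} u∉X =
    let (w , spans) = spanning-walk H-walk (allFin r) (type u) z
        (e , e-type , walk , e-coord) = lift-walk avoids u∉X refl w
    in record { corner = e ; corner-type = e-type ; walk = walk
              ; corner-coord = λ j j≢z → e-coord j j≢z (inj₁ (spans (∈-allFin j))) }

  connect : ∀ {X t} → Avoids X t → (z : Fin r) → ∀ {u v} → u ∉ X → v ∉ X →
            Walk (forget G) (_∉ X) u v
  connect {X} avoids z {u} {v} u∉X v∉X =
    walk c₁ ++ʷ subst (λ e → Walk (forget G) (_∉ X) e v) (sym same-corner)
                      (reverse G-sym (walk c₂))
    where
    open CornerWalk
    c₁ = corner-walk avoids z u∉X
    c₂ = corner-walk avoids z v∉X
    same-corner : corner c₁ ≡ corner c₂
    same-corner =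
      corner-unique (corner-type c₁) (corner-type c₂) (corner-coord c₁) (corner-coord c₂)

  used-copies : List V → List (Maybe (Fin q))
  used-copies = concatMap (λ x → map (λ j → coord j x) (allFin r))

  length-used-copies : ∀ X → length (used-copies X) ≡ r * length X
  length-used-copies []      = sym (*-zeroʳ r)
  length-used-copies (x ∷ X) = begin
    length (copies ++ used-copies X)        ≡⟨ length-++ copies ⟩
    length copies + length (used-copies X)  ≡⟨ cong₂ _+_ length-copies (length-used-copies X) ⟩
    r + r * length X                        ≡⟨ *-suc r (length X) ⟨
    r * suc (length X)                      ∎
    where
    open ≡-Reasoning
    copies = map (λ j → coord j x) (allFin r)
    length-copies : length copies ≡ r
    length-copies = trans (length-map _ (allFin r)) (length-tabulate id)

  avoiding-copy : ∀ X → r * length X < q → ∃ (Avoids X)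
  avoiding-copy X bound
    with fresh-image (Maybe.≡-dec _≟_) just-injective (used-copies X)
                     (subst (_< q) (sym (length-used-copies X)) bound)
  ... | t , unused = t , λ j x∈X in-t → unused (∈-concatMap⁺ _ (Any.map (used j in-t) x∈X))
    where
    used : ∀ j {x y} → coord j x ≡ just t → x ≡ y →
           just t ∈ map (λ j → coord j y) (allFin r)
    used j {x} in-t refl =
      subst (_∈ map (λ j → coord j x) (allFin r)) in-t (∈-map⁺ _ (∈-allFin j))

  k-connected : ∀ {k} → V → (z z′ : Fin r) → z′ ≢ z → r * k < q → KConnected k (forget G)
  k-connected {k} p z z′ z′≢z bound = (corner-at , corner-at-injective) , separated
    where
    open CornerWalk
    k<q : k < q
    k<q = ≤-<-trans (m≤n*m k r {{nonZeroIndex z}}) bound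
    corner-walk-at : (s : Fin (suc k)) → CornerWalk [] (inject≤ s k<q) z p
    corner-walk-at s = corner-walk (λ _ ()) z (λ ())
    corner-at : Fin (suc k) → V
    corner-at s = corner (corner-walk-at s)
    corner-at-coord : ∀ s → coord z′ (corner-at s) ≡ just (inject≤ s k<q)
    corner-at-coord s = corner-coord (corner-walk-at s) z′ z′≢z
    corner-at-injective : Injective _≡_ _≡_ corner-at
    corner-at-injective {s} {s′} eq = inject≤-injective k<q k<q s s′ (just-injective (begin
      just (inject≤ s k<q)    ≡⟨ corner-at-coord s ⟨
      coord z′ (corner-at s)  ≡⟨ cong (coord z′) eq ⟩
      coord z′ (corner-at s′) ≡⟨ corner-at-coord s′ ⟩
      just (inject≤ s′ k<q)   ∎))
      where open ≡-Reasoning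
    separated : ∀ X → length X < k → ∀ u v → u ∉ X → v ∉ X → Walk (forget G) (_∉ X) u v
    separated X |X|<k u v u∉X v∉X =
      connect (proj₂ (avoiding-copy X few-copies)) z u∉X v∉X
      where
      few-copies : r * length X < q
      few-copies = ≤-<-trans (*-monoʳ-≤ r (<⇒≤ |X|<k)) bound

theorem3 : ∀ {r} (H : FinGraph r) → 2 ≤ r → Connected (toGraph H) →
    ∀ (k : ℕ) → 1 ≤ k →
    Σ ℕ (λ q → 1 ≤ q × KConnected k (forget (bookpile q H)))
theorem3 {suc (suc r′)} H _ (_ , H-walk) k _ =
  q , s≤s z≤n ,
  k-connected (bookpile-coordinates q H) (bookpile-symmetric q H) H-walk
              (bookpile-inhabited (r * k) H zero) zero (suc zero) (λ ()) (n<1+n (r * k))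
  where
  r = suc (suc r′)
  q = suc (r * k)
theorem3 {1} _ (s≤s ()) _ _ _
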